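{- Let $v\in S_n$. Then $\Gamma_{[v,w_0]}=\Gamma_v\cup\{(i,j)\in[n]^2\setminus\Gamma_v : (i,j)\text{ is sandwiched by a non-inversion of } v\}$.
   Context: $S_n$ in one-line notation, Bruhat order, $w_0$ the longest element. $\Gamma_{[v,w_0]}:=\{(i,u_i): u\geq v,\ i\in[n]\}\subseteq[n]^2$ and $\Gamma_v:=\{(i,v_i):i\in[n]\}$, with $(i,j)$ = row $i$, column $j$. A non-inversion of $v$ is a pair $\langle k,l\rangle$ with $k<l$ and $v_k<v_l$. A cell $(i,j)\notin\Gamma_v$ is sandwiched by $\langle k,l\rangle$ if $k\le i\le l$ and $v_k\le j\le v_l$ or $v_k\ge j\ge v_l$ (i.e. it lies in the rectangle with opposite corners $(k,v_k)$ and $(l,v_l)$). -}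

module Defs where

open import Data.Nat using (ℕ)
open import Data.Fin using (Fin; _<_; _≤_)
open import Data.Fin.Permutation using (Permutation′; _⟨$⟩ʳ_; _∘ₚ_; transpose)
open import Data.Product using (Σ; _×_; ∃; ∃-syntax; _,_)
open import Data.Sum using (_⊎_)
open import Relation.Binary.PropositionalEquality using (_≡_; _≢_)
open import Relation.Binary.Construct.Closure.ReflexiveTransitive using (Star)

-- Permutations of [n] = Fin n; one-line notation: v_i = v ⟨$⟩ʳ i.
-- Cells are pairs (row i, column j) : Fin n × Fin n.

-- One Bruhat step: w = v · (a b) with a < b and v_a < v_b
-- (right multiplication by a transposition that increases length,
-- i.e. swapping the entries in positions a, b of a non-inversion).
BruhatStep : ∀ {n} → Permutation′ n → Permutation′ n → Set
BruhatStep {n} v w =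
  Σ (Fin n) λ a → Σ (Fin n) λ b →
    (a < b) × (v ⟨$⟩ʳ a < v ⟨$⟩ʳ b) ×
    (∀ x → w ⟨$⟩ʳ x ≡ (transpose a b ∘ₚ v) ⟨$⟩ʳ x)

_≤ᴮ_ : ∀ {n} → Permutation′ n → Permutation′ n → Set
_≤ᴮ_ = Star BruhatStep

InΓ : ∀ {n} → Permutation′ n → Fin n × Fin n → Set
InΓ v (i , j) = v ⟨$⟩ʳ i ≡ j

-- Γ_[v,w₀] : union of graphs of all u ≥ v (every u satisfies u ≤ w₀).
InΓInterval : ∀ {n} → Permutation′ n → Fin n × Fin n → Set
InΓInterval {n} v (i , j) = Σ (Permutation′ n) λ u → (v ≤ᴮ u) × (u ⟨$⟩ʳ i ≡ j)

NonInversion : ∀ {n} → Permutation′ n → Fin n → Fin n → Set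
NonInversion v k l = (k < l) × (v ⟨$⟩ʳ k < v ⟨$⟩ʳ l)

SandwichedBy : ∀ {n} → Permutation′ n → Fin n × Fin n → Fin n → Fin n → Set
SandwichedBy v (i , j) k l =
  (v ⟨$⟩ʳ i ≢ j) × (k ≤ i) × (i ≤ l) ×
  (((v ⟨$⟩ʳ k ≤ j) × (j ≤ v ⟨$⟩ʳ l)) ⊎ ((j ≤ v ⟨$⟩ʳ k) × (v ⟨$⟩ʳ l ≤ j)))

SandwichedByNonInv : ∀ {n} → Permutation′ n → Fin n × Fin n → Set
SandwichedByNonInv {n} v c =
  Σ (Fin n) λ k → Σ (Fin n) λ l → NonInversion v k l × SandwichedBy v c k l

module Submission where

-- Say a cell is *covered* by v if it lies on Γ_v or in the rectangle
-- [k,l] × [v_k,v_l] of a non-inversion ⟨k,l⟩ of v.  Since v_k < v_l, the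
-- second orientation in the definition of "sandwiched" never occurs, so the
-- covered cells are exactly Γ_v together with the sandwiched cells.
--
-- (⊆) A Bruhat step v → w = v·(a b) only moves the entries v_a, v_b inside
--     the rectangle of ⟨a,b⟩, so Γ_w is covered by v.  Consequently every
--     entry of w dominates (coordinatewise) an entry of v and is dominated
--     by one, so every rectangle of w lies in a rectangle of v, and coverage
--     by u ≥ v implies coverage by v, by induction along the chain.
-- (⊇) For a sandwiched cell (i,j) let p = v⁻¹(j).  If rows i and p form a
--     non-inversion (in either order), one swap moves j into row i.
--     Otherwise a first swap along ⟨k,i⟩ (resp. ⟨i,l⟩) creates such a
--     non-inversion and a second swap finishes.

open import Defs
open import Data.Nat using (ℕ)
open import Data.Fin using (Fin)
open import Data.Fin.Permutation using (Permutation′)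
open import Data.Product using (_×_)
open import Data.Sum using (_⊎_)
open import Function.Bundles using (_⇔_)

open import Data.Fin using (_<_; _≤_)
open import Data.Fin.Properties using (_≟_; <-cmp; ≤∧≢⇒<; <⇒≢; ≤-reflexive)
import Data.Fin.Permutation.Components as PC
open import Data.Fin.Permutation using (_⟨$⟩ʳ_; _⟨$⟩ˡ_; _∘ₚ_; transpose; inverseˡ; inverseʳ)
-- Fin n is ordered through toℕ, so the ℕ order lemmas apply directly.
import Data.Nat.Properties as ℕ
open import Data.Product using (Σ; _,_)
open import Data.Sum using (inj₁; inj₂)
open import Data.Empty using (⊥-elim)
open import Relation.Nullary using (yes; no)
open import Relation.Nullary.Decidable using (dec-true; dec-false)
open import Relation.Binary using (tri<; tri≈; tri>)
open import Relation.Binary.PropositionalEquality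
open import Relation.Binary.Construct.Closure.ReflexiveTransitive using (ε; _◅_)
open import Function.Bundles using (mk⇔)
open import Function using (_∘_)

module _ {n : ℕ} where

  entry-injective : ∀ (v : Permutation′ n) {x y} → v ⟨$⟩ʳ x ≡ v ⟨$⟩ʳ y → x ≡ y
  entry-injective v e =
    trans (sym (inverseˡ v)) (trans (cong (v ⟨$⟩ˡ_) e) (inverseˡ v))

  transpose-left : ∀ (a b : Fin n) → PC.transpose a b a ≡ b
  transpose-left a b rewrite dec-true (a ≟ a) refl = refl

  transpose-right : ∀ (a b : Fin n) → PC.transpose a b b ≡ a
  transpose-right a b with b ≟ a
  ... | yes b≡a = b≡a
  ... | no b≢a rewrite dec-true (b ≟ b) refl = refl

  transpose-other : ∀ (a b x : Fin n) → x ≢ a → x ≢ b → PC.transpose a b x ≡ x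
  transpose-other a b x x≢a x≢b rewrite dec-false (x ≟ a) x≢a | dec-false (x ≟ b) x≢b = refl

  swap : Permutation′ n → Fin n → Fin n → Permutation′ n
  swap v a b = transpose a b ∘ₚ v

  swap-left : ∀ v (a b : Fin n) → swap v a b ⟨$⟩ʳ a ≡ v ⟨$⟩ʳ b
  swap-left v a b = cong (v ⟨$⟩ʳ_) (transpose-left a b)

  swap-right : ∀ v (a b : Fin n) → swap v a b ⟨$⟩ʳ b ≡ v ⟨$⟩ʳ a
  swap-right v a b = cong (v ⟨$⟩ʳ_) (transpose-right a b)

  swap-other : ∀ v (a b x : Fin n) → x ≢ a → x ≢ b → swap v a b ⟨$⟩ʳ x ≡ v ⟨$⟩ʳ x
  swap-other v a b x x≢a x≢b = cong (v ⟨$⟩ʳ_) (transpose-other a b x x≢a x≢b)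

  swap-step : ∀ v {a b : Fin n} → NonInversion v a b → BruhatStep v (swap v a b)
  swap-step v {a} {b} (a<b , va<vb) = a , b , a<b , va<vb , λ _ → refl

  interval-step : ∀ {v w : Permutation′ n} {c} →
    BruhatStep v w → InΓInterval w c → InΓInterval v c
  interval-step s (u , w≤u , e) = u , s ◅ w≤u , e

  exchange : ∀ v {i p j : Fin n} → v ⟨$⟩ʳ p ≡ j →
    (i < p × v ⟨$⟩ʳ i < j) ⊎ (p < i × j < v ⟨$⟩ʳ i) → InΓInterval v (i , j)
  exchange v {i} {p} refl (inj₁ non-inv) =
    swap v i p , swap-step v non-inv ◅ ε , swap-left v i p
  exchange v {i} {p} refl (inj₂ non-inv) =
    swap v p i , swap-step v non-inv ◅ ε , swap-right v p i

  InBox : Fin n → Fin n → Fin n → Fin n → Fin n × Fin n → Set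
  InBox k l x y (i , j) = (k ≤ i) × (i ≤ l) × (x ≤ j) × (j ≤ y)

  Covered : Permutation′ n → Fin n × Fin n → Set
  Covered v c = InΓ v c ⊎
    Σ (Fin n) λ k → Σ (Fin n) λ l →
      NonInversion v k l × InBox k l (v ⟨$⟩ʳ k) (v ⟨$⟩ʳ l) c

  -- A Bruhat step keeps every entry in place except the two swapped ones,
  -- which stay in the rectangle of the swapped non-inversion: Γ_w ⊆ Covered v.
  step-graph-covered : ∀ {v w : Permutation′ n} → BruhatStep v w →
    ∀ {c} → InΓ w c → Covered v c
  step-graph-covered {v} {w} (a , b , a<b , va<vb , w≗) {i , j} refl
    with i ≟ a | i ≟ b
  ... | yes refl | _ = inj₂ (a , b , (a<b , va<vb) ,
        ℕ.≤-refl , ℕ.<⇒≤ a<b , subst (v ⟨$⟩ʳ a ≤_) (sym wa) (ℕ.<⇒≤ va<vb) ,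
        ≤-reflexive wa)
    where wa : w ⟨$⟩ʳ a ≡ v ⟨$⟩ʳ b
          wa = trans (w≗ a) (swap-left v a b)
  ... | no _ | yes refl = inj₂ (a , b , (a<b , va<vb) ,
        ℕ.<⇒≤ a<b , ℕ.≤-refl , ≤-reflexive (sym wb) ,
        subst (_≤ v ⟨$⟩ʳ b) (sym wb) (ℕ.<⇒≤ va<vb))
    where wb : w ⟨$⟩ʳ b ≡ v ⟨$⟩ʳ a
          wb = trans (w≗ b) (swap-right v a b)
  ... | no i≢a | no i≢b = inj₁ (sym (trans (w≗ i) (swap-other v a b i i≢a i≢b)))

  covered-lower-corner : ∀ {v : Permutation′ n} {i j} → Covered v (i , j) →
    Σ (Fin n) λ x → (x ≤ i) × (v ⟨$⟩ʳ x ≤ j)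
  covered-lower-corner {i = i} (inj₁ e) = i , ℕ.≤-refl , ≤-reflexive e
  covered-lower-corner (inj₂ (k , _ , _ , k≤i , _ , vk≤j , _)) = k , k≤i , vk≤j

  covered-upper-corner : ∀ {v : Permutation′ n} {i j} → Covered v (i , j) →
    Σ (Fin n) λ x → (i ≤ x) × (j ≤ v ⟨$⟩ʳ x)
  covered-upper-corner {i = i} (inj₁ e) = i , ℕ.≤-refl , ≤-reflexive (sym e)
  covered-upper-corner (inj₂ (_ , l , _ , _ , i≤l , _ , j≤vl)) = l , i≤l , j≤vl

  -- Coverage is inherited backwards along a Bruhat step: a rectangle of w
  -- lies in the rectangle of the non-inversion of v formed by an entry
  -- dominated by its lower corner and one dominating its upper corner.
  covered-step : ∀ {v w : Permutation′ n} → BruhatStep v w →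
    ∀ {c} → Covered w c → Covered v c
  covered-step {v} {w} s (inj₁ e) = step-graph-covered {v} {w} s e
  covered-step {v} {w} s (inj₂ (k , l , (k<l , wk<wl) , k≤i , i≤l , wk≤j , j≤wl))
    with covered-lower-corner {v} (step-graph-covered {v} {w} s {k , _} refl)
       | covered-upper-corner {v} (step-graph-covered {v} {w} s {l , _} refl)
  ... | k′ , k′≤k , vk′≤wk | l′ , l≤l′ , wl≤vl′ =
    inj₂ (k′ , l′ ,
      (ℕ.≤-<-trans k′≤k (ℕ.<-≤-trans k<l l≤l′) ,
       ℕ.≤-<-trans vk′≤wk (ℕ.<-≤-trans wk<wl wl≤vl′)) ,
      ℕ.≤-trans k′≤k k≤i , ℕ.≤-trans i≤l l≤l′ ,
      ℕ.≤-trans vk′≤wk wk≤j , ℕ.≤-trans j≤wl wl≤vl′)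

  covered-chain : ∀ {v u : Permutation′ n} → v ≤ᴮ u → ∀ {c} → Covered u c → Covered v c
  covered-chain ε cov = cov
  covered-chain {v} (_◅_ {j = w} s chain) cov = covered-step {v} {w} s (covered-chain chain cov)

  covered⇒sandwiched : ∀ {v : Permutation′ n} {c} →
    Covered v c → InΓ v c ⊎ SandwichedByNonInv v c
  covered⇒sandwiched (inj₁ e) = inj₁ e
  covered⇒sandwiched {v} {i , j} (inj₂ (k , l , non-inv , k≤i , i≤l , vk≤j , j≤vl))
    with v ⟨$⟩ʳ i ≟ j
  ... | yes e = inj₁ e
  ... | no vi≢j = inj₂ (k , l , non-inv , vi≢j , k≤i , i≤l , inj₁ (vk≤j , j≤vl))

  -- i < p = v⁻¹(j) but v_i > j: an entry (k, v_k) dominated by (i,j) is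
  -- strictly dominated, and the swap along ⟨k,i⟩ puts
  -- v_k < j into row i, after which `exchange` moves j there.
  exchange-via-lower : ∀ v {i k j : Fin n} → k ≤ i → v ⟨$⟩ʳ k ≤ j →
    i < v ⟨$⟩ˡ j → j < v ⟨$⟩ʳ i → InΓInterval v (i , j)
  exchange-via-lower v {i} {k} {j} k≤i vk≤j i<p j<vi =
    interval-step (swap-step v (k<i , ℕ.<-trans vk<j j<vi))
      (exchange w wp≡j (inj₁ (i<p , subst (_< j) (sym (swap-right v k i)) vk<j)))
    where
      p = v ⟨$⟩ˡ j
      k<i : k < i
      k<i = ≤∧≢⇒< k≤i λ { refl → ℕ.<-irrefl refl (ℕ.≤-<-trans vk≤j j<vi) }
      k<p : k < p
      k<p = ℕ.<-trans k<i i<p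
      vk<j : v ⟨$⟩ʳ k < j
      vk<j = ≤∧≢⇒< vk≤j λ vk≡j → <⇒≢ k<p (entry-injective v (trans vk≡j (sym (inverseʳ v))))
      w = swap v k i
      wp≡j : w ⟨$⟩ʳ p ≡ j
      wp≡j = trans (swap-other v k i p (<⇒≢ k<p ∘ sym) (<⇒≢ i<p ∘ sym)) (inverseʳ v)

  -- The mirror image: p = v⁻¹(j) < i but v_i < j; swap along ⟨i,l⟩ for an
  -- entry (l, v_l) dominating (i,j).
  exchange-via-upper : ∀ v {i l j : Fin n} → i ≤ l → j ≤ v ⟨$⟩ʳ l →
    v ⟨$⟩ˡ j < i → v ⟨$⟩ʳ i < j → InΓInterval v (i , j)
  exchange-via-upper v {i} {l} {j} i≤l j≤vl p<i vi<j =
    interval-step (swap-step v (i<l , ℕ.<-trans vi<j j<vl))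
      (exchange w wp≡j (inj₂ (p<i , subst (j <_) (sym (swap-left v i l)) j<vl)))
    where
      p = v ⟨$⟩ˡ j
      i<l : i < l
      i<l = ≤∧≢⇒< i≤l λ { refl → ℕ.<-irrefl refl (ℕ.<-≤-trans vi<j j≤vl) }
      p<l : p < l
      p<l = ℕ.<-trans p<i i<l
      j<vl : j < v ⟨$⟩ʳ l
      j<vl = ≤∧≢⇒< j≤vl λ j≡vl → <⇒≢ p<l (entry-injective v (trans (inverseʳ v) j≡vl))
      w = swap v i l
      wp≡j : w ⟨$⟩ʳ p ≡ j
      wp≡j = trans (swap-other v i l p (<⇒≢ p<i) (<⇒≢ p<l)) (inverseʳ v)

  -- Sandwiched cells are reached by at most two swaps, according to the
  -- position of (i,j) relative to the entries (i, v_i) and (v⁻¹(j), j).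
  -- (The anti-diagonal orientation is impossible since v_k < v_l.)
  sandwiched⇒interval : ∀ {v : Permutation′ n} {c} →
    SandwichedByNonInv v c → InΓInterval v c
  sandwiched⇒interval (k , l , (_ , vk<vl) , _ , _ , _ , inj₂ (j≤vk , vl≤j)) =
    ⊥-elim (ℕ.<-irrefl refl (ℕ.<-≤-trans vk<vl (ℕ.≤-trans vl≤j j≤vk)))
  sandwiched⇒interval {v} {i , j} (k , l , _ , vi≢j , k≤i , i≤l , inj₁ (vk≤j , j≤vl))
    with <-cmp i (v ⟨$⟩ˡ j) | <-cmp (v ⟨$⟩ʳ i) j
  ... | tri≈ _ i≡p _ | _ = ⊥-elim (vi≢j (trans (cong (v ⟨$⟩ʳ_) i≡p) (inverseʳ v)))
  ... | _ | tri≈ _ vi≡j _ = ⊥-elim (vi≢j vi≡j)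
  ... | tri< i<p _ _ | tri< vi<j _ _ = exchange v (inverseʳ v) (inj₁ (i<p , vi<j))
  ... | tri> _ _ p<i | tri> _ _ j<vi = exchange v (inverseʳ v) (inj₂ (p<i , j<vi))
  ... | tri< i<p _ _ | tri> _ _ j<vi = exchange-via-lower v k≤i vk≤j i<p j<vi
  ... | tri> _ _ p<i | tri< vi<j _ _ = exchange-via-upper v i≤l j≤vl p<i vi<j

lemma2p4 : ∀ (n : ℕ) (v : Permutation′ n) (c : Fin n × Fin n) →
    InΓInterval v c ⇔ (InΓ v c ⊎ SandwichedByNonInv v c)
lemma2p4 n v c = mk⇔ interval⇒ ⇒interval
  where
    interval⇒ : InΓInterval v c → InΓ v c ⊎ SandwichedByNonInv v c
    interval⇒ (u , v≤u , on-u) = covered⇒sandwiched {v = v} (covered-chain v≤u (inj₁ on-u))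

    ⇒interval : InΓ v c ⊎ SandwichedByNonInv v c → InΓInterval v c
    ⇒interval (inj₁ on-v) = v , ε , on-v
    ⇒interval (inj₂ sandwiched) = sandwiched⇒interval sandwiched
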